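{- Let $\varphi$ be a pattern and $x,y$ element variables such that $x$ is free for $y$ in $\varphi$. Then $\vdash_{\mathcal{MG}^c}\mathrm{Subf}_x^y\varphi\to\exists x\varphi$.
   Context: Fix a countably infinite set $EVar$ of element variables and a set $\Sigma$ of constant symbols containing a distinguished "definedness symbol" $\lceil\,\rceil$. Patterns: $\varphi::= x\mid \sigma\mid \bot\mid \neg\varphi\mid \varphi\to\varphi\mid \varphi\wedge\varphi\mid\varphi\vee\varphi\mid \varphi\cdot\varphi\mid \forall x\varphi\mid\exists x\varphi$ ($\varphi\cdot\psi$ is application). Abbreviations: $\varphi\leftrightarrow\psi:=(\varphi\to\psi)\wedge(\psi\to\varphi)$, $\lceil\varphi\rceil:=\lceil\,\rceil\cdot\varphi$, $\lfloor\varphi\rfloor:=\neg\lceil\neg\varphi\rceil$, $\varphi=\psi:=\lfloor\varphi\leftrightarrow\psi\rfloor$. An occurrence of $x$ is bound if inside a subpattern $\forall x\theta$ or $\exists x\theta$, otherwise free. $\mathrm{Subf}_x^y\varphi$ is the result of replacing every free occurrence of $x$ in $\varphi$ by $y$; "$x$ is free for $y$ in $\varphi$" means no free occurrence of $x$ in $\varphi$ lies inside a subpattern of the form $\forall y\theta$ or $\exists y\theta$. $\vdash\psi$ means there is a finite sequence ending in $\psi$ of axiom instances or consequences of earlier members by rules. Proof system $\mathcal{MG}^c$. Axioms: $\varphi\vee\varphi\to\varphi$; $\varphi\to\varphi\wedge\varphi$; $\varphi\to\varphi\vee\psi$; $\varphi\wedge\psi\to\varphi$; $\varphi\vee\psi\to\psi\vee\varphi$;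 $\varphi\wedge\psi\to\psi\wedge\varphi$; $\bot\to\varphi$; $\varphi\vee\neg\varphi$; $\neg\varphi\to(\varphi\to\bot)$; $(\varphi\to\bot)\to\neg\varphi$; $\forall x(\varphi\to\psi)\to(\forall x\varphi\to\forall x\psi)$; $\varphi\to\forall x\varphi$ if $x$ does not occur in $\varphi$; $\exists x(x=y)$ for $y$ distinct from $x$; $\exists x\varphi\to\neg\forall x\neg\varphi$; $\neg\forall x\neg\varphi\to\exists x\varphi$; $(\varphi\vee\psi)\cdot\chi\to\varphi\cdot\chi\vee\psi\cdot\chi$; $\chi\cdot(\varphi\vee\psi)\to\chi\cdot\varphi\vee\chi\cdot\psi$; $(\exists x\varphi)\cdot\psi\to\exists x(\varphi\cdot\psi)$ and $\psi\cdot(\exists x\varphi)\to\exists x(\psi\cdot\varphi)$ if $x$ does not occur in $\psi$; $\lceil\varphi\rceil\cdot\psi\to\lceil\varphi\rceil$; $\psi\cdot\lceil\varphi\rceil\to\lceil\varphi\rceil$; $\lceil x\rceil$; $\varphi\to\lceil\varphi\rceil$; $\lceil\bot\rceil\to\bot$. Rules: from $\varphi$, $\varphi\to\psi$ infer $\psi$; from $\varphi\to\psi$, $\psi\to\chi$ infer $\varphi\to\chi$; from $\varphi\wedge\psi\to\chi$ infer $\varphi\to(\psi\to\chi)$; from $\varphi\to(\psi\to\chi)$ infer $\varphi\wedge\psi\to\chi$; from $\varphi\to\psi$ infer $\chi\vee\varphi\to\chi\vee\psi$; from $\varphi$ infer $\forall x\varphi$; from $\varphi\to\psi$ infer $\varphi\cdot\chi\to\psi\cdot\chi$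 and $\chi\cdot\varphi\to\chi\cdot\psi$. -}

module Defs where

open import Data.Nat using (ℕ; _≟_)
open import Data.Empty using (⊥)
open import Data.Unit using (⊤)
open import Data.Product using (_×_)
open import Data.Sum using (_⊎_)
open import Relation.Nullary using (¬_; yes; no)
open import Relation.Binary.PropositionalEquality using (_≡_; _≢_)

EVar : Set
EVar = ℕ

-- The development is parametric in the set Σ of constant symbols and its
-- distinguished definedness symbol ⌈⌉.
module MG (Sym : Set) (dfd : Sym) where

  infixr 4 _⇒_
  infixl 6 _∧_
  infixl 5 _∨_
  infixl 8 _·_

  data Pattern : Set where
    var  : EVar → Pattern
    sym  : Sym → Pattern
    ⊥p   : Pattern
    ¬p   : Pattern → Pattern
    _⇒_  : Pattern → Pattern → Pattern
    _∧_  : Pattern → Pattern → Pattern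
    _∨_  : Pattern → Pattern → Pattern
    _·_  : Pattern → Pattern → Pattern
    ∀p   : EVar → Pattern → Pattern
    ∃p   : EVar → Pattern → Pattern

  _⇔_ : Pattern → Pattern → Pattern
  φ ⇔ ψ = (φ ⇒ ψ) ∧ (ψ ⇒ φ)

  ⌈_⌉ : Pattern → Pattern
  ⌈ φ ⌉ = sym dfd · φ

  ⌊_⌋ : Pattern → Pattern
  ⌊ φ ⌋ = ¬p ⌈ ¬p φ ⌉

  _≐_ : Pattern → Pattern → Pattern
  φ ≐ ψ = ⌊ φ ⇔ ψ ⌋

  Occurs : EVar → Pattern → Set
  Occurs x (var z)   = x ≡ z
  Occurs x (sym _)   = ⊥
  Occurs x ⊥p        = ⊥
  Occurs x (¬p φ)    = Occurs x φ
  Occurs x (φ ⇒ ψ)   = Occurs x φ ⊎ Occurs x ψ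
  Occurs x (φ ∧ ψ)   = Occurs x φ ⊎ Occurs x ψ
  Occurs x (φ ∨ ψ)   = Occurs x φ ⊎ Occurs x ψ
  Occurs x (φ · ψ)   = Occurs x φ ⊎ Occurs x ψ
  Occurs x (∀p z φ)  = x ≡ z ⊎ Occurs x φ
  Occurs x (∃p z φ)  = x ≡ z ⊎ Occurs x φ

  FreeIn : EVar → Pattern → Set
  FreeIn x (var z)   = x ≡ z
  FreeIn x (sym _)   = ⊥
  FreeIn x ⊥p        = ⊥
  FreeIn x (¬p φ)    = FreeIn x φ
  FreeIn x (φ ⇒ ψ)   = FreeIn x φ ⊎ FreeIn x ψ
  FreeIn x (φ ∧ ψ)   = FreeIn x φ ⊎ FreeIn x ψ
  FreeIn x (φ ∨ ψ)   = FreeIn x φ ⊎ FreeIn x ψ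
  FreeIn x (φ · ψ)   = FreeIn x φ ⊎ FreeIn x ψ
  FreeIn x (∀p z φ)  = x ≢ z × FreeIn x φ
  FreeIn x (∃p z φ)  = x ≢ z × FreeIn x φ

  Subf : EVar → EVar → Pattern → Pattern
  Subf x y (var z) with x ≟ z
  ... | yes _ = var y
  ... | no  _ = var z
  Subf x y (sym s)   = sym s
  Subf x y ⊥p        = ⊥p
  Subf x y (¬p φ)    = ¬p (Subf x y φ)
  Subf x y (φ ⇒ ψ)   = Subf x y φ ⇒ Subf x y ψ
  Subf x y (φ ∧ ψ)   = Subf x y φ ∧ Subf x y ψ
  Subf x y (φ ∨ ψ)   = Subf x y φ ∨ Subf x y ψ
  Subf x y (φ · ψ)   = Subf x y φ · Subf x y ψ
  Subf x y (∀p z φ) with x ≟ z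
  ... | yes _ = ∀p z φ
  ... | no  _ = ∀p z (Subf x y φ)
  Subf x y (∃p z φ) with x ≟ z
  ... | yes _ = ∃p z φ
  ... | no  _ = ∃p z (Subf x y φ)

  -- "x is free for y in φ": no free occurrence of x in φ lies inside a
  -- subpattern of the form ∀y θ or ∃y θ.
  FreeFor : EVar → EVar → Pattern → Set
  FreeFor x y (var z)   = ⊤
  FreeFor x y (sym _)   = ⊤
  FreeFor x y ⊥p        = ⊤
  FreeFor x y (¬p φ)    = FreeFor x y φ
  FreeFor x y (φ ⇒ ψ)   = FreeFor x y φ × FreeFor x y ψ
  FreeFor x y (φ ∧ ψ)   = FreeFor x y φ × FreeFor x y ψ
  FreeFor x y (φ ∨ ψ)   = FreeFor x y φ × FreeFor x y ψ
  FreeFor x y (φ · ψ)   = FreeFor x y φ × FreeFor x y ψ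
  FreeFor x y (∀p z φ)  = ¬ FreeIn x (∀p z φ) ⊎ (y ≢ z × FreeFor x y φ)
  FreeFor x y (∃p z φ)  = ¬ FreeIn x (∃p z φ) ⊎ (y ≢ z × FreeFor x y φ)

  infix 2 ⊢_
  data ⊢_ : Pattern → Set where
    ax-∨-idem  : ∀ φ → ⊢ φ ∨ φ ⇒ φ
    ax-∧-dup   : ∀ φ → ⊢ φ ⇒ φ ∧ φ
    ax-∨-intro : ∀ φ ψ → ⊢ φ ⇒ φ ∨ ψ
    ax-∧-elim  : ∀ φ ψ → ⊢ φ ∧ ψ ⇒ φ
    ax-∨-comm  : ∀ φ ψ → ⊢ φ ∨ ψ ⇒ ψ ∨ φ
    ax-∧-comm  : ∀ φ ψ → ⊢ φ ∧ ψ ⇒ ψ ∧ φ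
    ax-⊥       : ∀ φ → ⊢ ⊥p ⇒ φ
    ax-lem     : ∀ φ → ⊢ φ ∨ ¬p φ
    ax-¬⇒      : ∀ φ → ⊢ ¬p φ ⇒ (φ ⇒ ⊥p)
    ax-⇒¬      : ∀ φ → ⊢ (φ ⇒ ⊥p) ⇒ ¬p φ
    ax-∀-dist  : ∀ x φ ψ → ⊢ ∀p x (φ ⇒ ψ) ⇒ (∀p x φ ⇒ ∀p x ψ)
    ax-∀-vac   : ∀ x φ → ¬ Occurs x φ → ⊢ φ ⇒ ∀p x φ
    ax-exists  : ∀ x y → y ≢ x → ⊢ ∃p x (var x ≐ var y)
    ax-∃⇒¬∀¬   : ∀ x φ → ⊢ ∃p x φ ⇒ ¬p (∀p x (¬p φ))
    ax-¬∀¬⇒∃   : ∀ x φ → ⊢ ¬p (∀p x (¬p φ)) ⇒ ∃p x φ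
    ax-prop-∨ˡ : ∀ φ ψ χ → ⊢ (φ ∨ ψ) · χ ⇒ φ · χ ∨ ψ · χ
    ax-prop-∨ʳ : ∀ φ ψ χ → ⊢ χ · (φ ∨ ψ) ⇒ χ · φ ∨ χ · ψ
    ax-prop-∃ˡ : ∀ x φ ψ → ¬ Occurs x ψ → ⊢ (∃p x φ) · ψ ⇒ ∃p x (φ · ψ)
    ax-prop-∃ʳ : ∀ x φ ψ → ¬ Occurs x ψ → ⊢ ψ · (∃p x φ) ⇒ ∃p x (ψ · φ)
    ax-dfdˡ    : ∀ φ ψ → ⊢ ⌈ φ ⌉ · ψ ⇒ ⌈ φ ⌉
    ax-dfdʳ    : ∀ φ ψ → ⊢ ψ · ⌈ φ ⌉ ⇒ ⌈ φ ⌉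
    ax-dfd-var : ∀ x → ⊢ ⌈ var x ⌉
    ax-dfd-in  : ∀ φ → ⊢ φ ⇒ ⌈ φ ⌉
    ax-dfd-⊥   : ⊢ ⌈ ⊥p ⌉ ⇒ ⊥p
    r-mp       : ∀ {φ ψ} → ⊢ φ → ⊢ φ ⇒ ψ → ⊢ ψ
    r-syll     : ∀ {φ ψ χ} → ⊢ φ ⇒ ψ → ⊢ ψ ⇒ χ → ⊢ φ ⇒ χ
    r-exp      : ∀ {φ ψ χ} → ⊢ φ ∧ ψ ⇒ χ → ⊢ φ ⇒ (ψ ⇒ χ)
    r-imp      : ∀ {φ ψ χ} → ⊢ φ ⇒ (ψ ⇒ χ) → ⊢ φ ∧ ψ ⇒ χ
    r-∨        : ∀ {φ ψ} χ → ⊢ φ ⇒ ψ → ⊢ χ ∨ φ ⇒ χ ∨ ψ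
    r-gen      : ∀ {φ} x → ⊢ φ → ⊢ ∀p x φ
    r-frameˡ   : ∀ {φ ψ} χ → ⊢ φ ⇒ ψ → ⊢ φ · χ ⇒ ψ · χ
    r-frameʳ   : ∀ {φ ψ} χ → ⊢ φ ⇒ ψ → ⊢ χ · φ ⇒ χ · ψ

{-# OPTIONS --safe #-}
-- For x ≢ y the pattern Subf x y φ has no free x, so it implies ∀x Subf x y φ;
-- together with the axiom ∃x (x = y) this yields ∃x (x = y ∧ Subf x y φ), and
-- the Leibniz property of equality, x = y ∧ Subf x y φ → φ, gives ∃x φ.
-- Two points need care. The axiom φ → ∀x φ demands that x not occur in φ at
-- all, so bound occurrences of x are first renamed away (α-conversion, itself
-- an instance of the Leibniz property). In the Leibniz property the equation
-- must be carried through application; this works because it is a ⌊_⌋-pattern,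
-- whose negation is a definedness pattern and so absorbs application. The case
-- y = x reduces to the first through a fresh variable.
module Submission where

open import Defs
open import Data.Nat using (ℕ; suc; _≟_; _⊔_; _<_; s≤s)
open import Data.Nat.Properties using (≟-diag; m≤m⊔n; m≤n⊔m; m⊔n<o⇒m<o; m⊔n<o⇒n<o; >⇒≢)
open import Data.Empty using (⊥-elim)
open import Data.Unit using (⊤; tt)
open import Data.Product using (_×_; _,_; proj₁; proj₂; swap)
open import Data.Sum using (inj₁; inj₂; [_,_])
open import Function using (_∘_)
open import Relation.Nullary using (¬_; Dec; yes; no)
open import Relation.Nullary.Decidable using (dec-no)
open import Relation.Binary.PropositionalEquality
  using (_≡_; _≢_; refl; cong; cong₂; subst; ≢-sym) renaming (sym to ≡-sym)

module Metatheory (Sym : Set) (dfd : Sym) where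
  open MG Sym dfd

  private variable
    x y z : EVar
    a a′ b b′ c d Γ Q : Pattern

  Subf-self : ∀ x φ → Subf x x φ ≡ φ
  Subf-self x (var w) with x ≟ w
  ... | yes x≡w = cong var x≡w
  ... | no _ = refl
  Subf-self x (sym s) = refl
  Subf-self x ⊥p = refl
  Subf-self x (¬p φ) = cong ¬p (Subf-self x φ)
  Subf-self x (φ ⇒ ψ) = cong₂ _⇒_ (Subf-self x φ) (Subf-self x ψ)
  Subf-self x (φ ∧ ψ) = cong₂ _∧_ (Subf-self x φ) (Subf-self x ψ)
  Subf-self x (φ ∨ ψ) = cong₂ _∨_ (Subf-self x φ) (Subf-self x ψ)
  Subf-self x (φ · ψ) = cong₂ _·_ (Subf-self x φ) (Subf-self x ψ)
  Subf-self x (∀p w φ) with x ≟ w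
  ... | yes _ = refl
  ... | no _ = cong (∀p w) (Subf-self x φ)
  Subf-self x (∃p w φ) with x ≟ w
  ... | yes _ = refl
  ... | no _ = cong (∃p w) (Subf-self x φ)

  Subf-¬FreeIn : ∀ φ → ¬ FreeIn x φ → Subf x y φ ≡ φ
  Subf-¬FreeIn {x} (var w) x∉φ with x ≟ w
  ... | yes x≡w = ⊥-elim (x∉φ x≡w)
  ... | no _ = refl
  Subf-¬FreeIn (sym s) x∉φ = refl
  Subf-¬FreeIn ⊥p x∉φ = refl
  Subf-¬FreeIn (¬p φ) x∉φ = cong ¬p (Subf-¬FreeIn φ x∉φ)
  Subf-¬FreeIn (φ ⇒ ψ) x∉φ = cong₂ _⇒_ (Subf-¬FreeIn φ (x∉φ ∘ inj₁)) (Subf-¬FreeIn ψ (x∉φ ∘ inj₂))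
  Subf-¬FreeIn (φ ∧ ψ) x∉φ = cong₂ _∧_ (Subf-¬FreeIn φ (x∉φ ∘ inj₁)) (Subf-¬FreeIn ψ (x∉φ ∘ inj₂))
  Subf-¬FreeIn (φ ∨ ψ) x∉φ = cong₂ _∨_ (Subf-¬FreeIn φ (x∉φ ∘ inj₁)) (Subf-¬FreeIn ψ (x∉φ ∘ inj₂))
  Subf-¬FreeIn (φ · ψ) x∉φ = cong₂ _·_ (Subf-¬FreeIn φ (x∉φ ∘ inj₁)) (Subf-¬FreeIn ψ (x∉φ ∘ inj₂))
  Subf-¬FreeIn {x} (∀p w φ) x∉φ with x ≟ w
  ... | yes _ = refl
  ... | no x≢w = cong (∀p w) (Subf-¬FreeIn φ (x∉φ ∘ (x≢w ,_)))
  Subf-¬FreeIn {x} (∃p w φ) x∉φ with x ≟ w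
  ... | yes _ = refl
  ... | no x≢w = cong (∃p w) (Subf-¬FreeIn φ (x∉φ ∘ (x≢w ,_)))

  ¬FreeIn-Subf : ∀ φ → x ≢ y → ¬ FreeIn x (Subf x y φ)
  ¬FreeIn-Subf {x} (var w) x≢y with x ≟ w
  ... | yes _ = x≢y
  ... | no x≢w = x≢w
  ¬FreeIn-Subf (sym s) x≢y ()
  ¬FreeIn-Subf ⊥p x≢y ()
  ¬FreeIn-Subf (¬p φ) x≢y = ¬FreeIn-Subf φ x≢y
  ¬FreeIn-Subf (φ ⇒ ψ) x≢y = [ ¬FreeIn-Subf φ x≢y , ¬FreeIn-Subf ψ x≢y ]
  ¬FreeIn-Subf (φ ∧ ψ) x≢y = [ ¬FreeIn-Subf φ x≢y , ¬FreeIn-Subf ψ x≢y ]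
  ¬FreeIn-Subf (φ ∨ ψ) x≢y = [ ¬FreeIn-Subf φ x≢y , ¬FreeIn-Subf ψ x≢y ]
  ¬FreeIn-Subf (φ · ψ) x≢y = [ ¬FreeIn-Subf φ x≢y , ¬FreeIn-Subf ψ x≢y ]
  ¬FreeIn-Subf {x} (∀p w φ) x≢y with x ≟ w
  ... | yes x≡w = λ (x≢w , _) → x≢w x≡w
  ... | no _ = ¬FreeIn-Subf φ x≢y ∘ proj₂
  ¬FreeIn-Subf {x} (∃p w φ) x≢y with x ≟ w
  ... | yes x≡w = λ (x≢w , _) → x≢w x≡w
  ... | no _ = ¬FreeIn-Subf φ x≢y ∘ proj₂

  ¬Occurs⇒¬FreeIn : ∀ φ → ¬ Occurs z φ → ¬ FreeIn z φ
  ¬Occurs⇒¬FreeIn (var w) z∉φ = z∉φ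
  ¬Occurs⇒¬FreeIn (sym s) z∉φ ()
  ¬Occurs⇒¬FreeIn ⊥p z∉φ ()
  ¬Occurs⇒¬FreeIn (¬p φ) z∉φ = ¬Occurs⇒¬FreeIn φ z∉φ
  ¬Occurs⇒¬FreeIn (φ ⇒ ψ) z∉φ = [ ¬Occurs⇒¬FreeIn φ (z∉φ ∘ inj₁) , ¬Occurs⇒¬FreeIn ψ (z∉φ ∘ inj₂) ]
  ¬Occurs⇒¬FreeIn (φ ∧ ψ) z∉φ = [ ¬Occurs⇒¬FreeIn φ (z∉φ ∘ inj₁) , ¬Occurs⇒¬FreeIn ψ (z∉φ ∘ inj₂) ]
  ¬Occurs⇒¬FreeIn (φ ∨ ψ) z∉φ = [ ¬Occurs⇒¬FreeIn φ (z∉φ ∘ inj₁) , ¬Occurs⇒¬FreeIn ψ (z∉φ ∘ inj₂) ]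
  ¬Occurs⇒¬FreeIn (φ · ψ) z∉φ = [ ¬Occurs⇒¬FreeIn φ (z∉φ ∘ inj₁) , ¬Occurs⇒¬FreeIn ψ (z∉φ ∘ inj₂) ]
  ¬Occurs⇒¬FreeIn (∀p w φ) z∉φ = ¬Occurs⇒¬FreeIn φ (z∉φ ∘ inj₂) ∘ proj₂
  ¬Occurs⇒¬FreeIn (∃p w φ) z∉φ = ¬Occurs⇒¬FreeIn φ (z∉φ ∘ inj₂) ∘ proj₂

  ¬Occurs⇒FreeFor : ∀ φ → ¬ Occurs z φ → FreeFor x z φ
  ¬Occurs⇒FreeFor (var w) z∉φ = tt
  ¬Occurs⇒FreeFor (sym s) z∉φ = tt
  ¬Occurs⇒FreeFor ⊥p z∉φ = tt
  ¬Occurs⇒FreeFor (¬p φ) z∉φ = ¬Occurs⇒FreeFor φ z∉φ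
  ¬Occurs⇒FreeFor (φ ⇒ ψ) z∉φ = ¬Occurs⇒FreeFor φ (z∉φ ∘ inj₁) , ¬Occurs⇒FreeFor ψ (z∉φ ∘ inj₂)
  ¬Occurs⇒FreeFor (φ ∧ ψ) z∉φ = ¬Occurs⇒FreeFor φ (z∉φ ∘ inj₁) , ¬Occurs⇒FreeFor ψ (z∉φ ∘ inj₂)
  ¬Occurs⇒FreeFor (φ ∨ ψ) z∉φ = ¬Occurs⇒FreeFor φ (z∉φ ∘ inj₁) , ¬Occurs⇒FreeFor ψ (z∉φ ∘ inj₂)
  ¬Occurs⇒FreeFor (φ · ψ) z∉φ = ¬Occurs⇒FreeFor φ (z∉φ ∘ inj₁) , ¬Occurs⇒FreeFor ψ (z∉φ ∘ inj₂)
  ¬Occurs⇒FreeFor (∀p w φ) z∉φ = inj₂ (z∉φ ∘ inj₁ , ¬Occurs⇒FreeFor φ (z∉φ ∘ inj₂))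
  ¬Occurs⇒FreeFor (∃p w φ) z∉φ = inj₂ (z∉φ ∘ inj₁ , ¬Occurs⇒FreeFor φ (z∉φ ∘ inj₂))

  Subf-inverse : ∀ x φ → ¬ Occurs z φ → Subf z x (Subf x z φ) ≡ φ
  Subf-inverse {z} x (var w) z∉φ with x ≟ w
  ... | yes refl rewrite ≟-diag (refl {x = z}) = refl
  ... | no _ rewrite dec-no (z ≟ w) z∉φ = refl
  Subf-inverse x (sym s) z∉φ = refl
  Subf-inverse x ⊥p z∉φ = refl
  Subf-inverse x (¬p φ) z∉φ = cong ¬p (Subf-inverse x φ z∉φ)
  Subf-inverse x (φ ⇒ ψ) z∉φ =
    cong₂ _⇒_ (Subf-inverse x φ (z∉φ ∘ inj₁)) (Subf-inverse x ψ (z∉φ ∘ inj₂))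
  Subf-inverse x (φ ∧ ψ) z∉φ =
    cong₂ _∧_ (Subf-inverse x φ (z∉φ ∘ inj₁)) (Subf-inverse x ψ (z∉φ ∘ inj₂))
  Subf-inverse x (φ ∨ ψ) z∉φ =
    cong₂ _∨_ (Subf-inverse x φ (z∉φ ∘ inj₁)) (Subf-inverse x ψ (z∉φ ∘ inj₂))
  Subf-inverse x (φ · ψ) z∉φ =
    cong₂ _·_ (Subf-inverse x φ (z∉φ ∘ inj₁)) (Subf-inverse x ψ (z∉φ ∘ inj₂))
  Subf-inverse {z} x (∀p w φ) z∉φ with x ≟ w
  ... | yes refl rewrite dec-no (z ≟ x) (z∉φ ∘ inj₁) =
    cong (∀p x) (Subf-¬FreeIn φ (¬Occurs⇒¬FreeIn φ (z∉φ ∘ inj₂)))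
  ... | no _ rewrite dec-no (z ≟ w) (z∉φ ∘ inj₁) = cong (∀p w) (Subf-inverse x φ (z∉φ ∘ inj₂))
  Subf-inverse {z} x (∃p w φ) z∉φ with x ≟ w
  ... | yes refl rewrite dec-no (z ≟ x) (z∉φ ∘ inj₁) =
    cong (∃p x) (Subf-¬FreeIn φ (¬Occurs⇒¬FreeIn φ (z∉φ ∘ inj₂)))
  ... | no _ rewrite dec-no (z ≟ w) (z∉φ ∘ inj₁) = cong (∃p w) (Subf-inverse x φ (z∉φ ∘ inj₂))

  NoBinder : EVar → Pattern → Set
  NoBinder x (var _) = ⊤
  NoBinder x (sym _) = ⊤
  NoBinder x ⊥p = ⊤
  NoBinder x (¬p φ) = NoBinder x φ
  NoBinder x (φ ⇒ ψ) = NoBinder x φ × NoBinder x ψ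
  NoBinder x (φ ∧ ψ) = NoBinder x φ × NoBinder x ψ
  NoBinder x (φ ∨ ψ) = NoBinder x φ × NoBinder x ψ
  NoBinder x (φ · ψ) = NoBinder x φ × NoBinder x ψ
  NoBinder x (∀p w φ) = x ≢ w × NoBinder x φ
  NoBinder x (∃p w φ) = x ≢ w × NoBinder x φ

  NoBinder⇒FreeFor : ∀ φ → NoBinder y φ → FreeFor x y φ
  NoBinder⇒FreeFor (var w) _ = tt
  NoBinder⇒FreeFor (sym s) _ = tt
  NoBinder⇒FreeFor ⊥p _ = tt
  NoBinder⇒FreeFor (¬p φ) nb = NoBinder⇒FreeFor φ nb
  NoBinder⇒FreeFor (φ ⇒ ψ) (nbφ , nbψ) = NoBinder⇒FreeFor φ nbφ , NoBinder⇒FreeFor ψ nbψ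
  NoBinder⇒FreeFor (φ ∧ ψ) (nbφ , nbψ) = NoBinder⇒FreeFor φ nbφ , NoBinder⇒FreeFor ψ nbψ
  NoBinder⇒FreeFor (φ ∨ ψ) (nbφ , nbψ) = NoBinder⇒FreeFor φ nbφ , NoBinder⇒FreeFor ψ nbψ
  NoBinder⇒FreeFor (φ · ψ) (nbφ , nbψ) = NoBinder⇒FreeFor φ nbφ , NoBinder⇒FreeFor ψ nbψ
  NoBinder⇒FreeFor (∀p w φ) (y≢w , nb) = inj₂ (y≢w , NoBinder⇒FreeFor φ nb)
  NoBinder⇒FreeFor (∃p w φ) (y≢w , nb) = inj₂ (y≢w , NoBinder⇒FreeFor φ nb)

  NoBinder-Subf : ∀ φ → NoBinder x φ → NoBinder x (Subf y z φ)
  NoBinder-Subf {y = y} (var w) nb with y ≟ w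
  ... | yes _ = tt
  ... | no _ = tt
  NoBinder-Subf (sym s) nb = tt
  NoBinder-Subf ⊥p nb = tt
  NoBinder-Subf (¬p φ) nb = NoBinder-Subf φ nb
  NoBinder-Subf (φ ⇒ ψ) (nbφ , nbψ) = NoBinder-Subf φ nbφ , NoBinder-Subf ψ nbψ
  NoBinder-Subf (φ ∧ ψ) (nbφ , nbψ) = NoBinder-Subf φ nbφ , NoBinder-Subf ψ nbψ
  NoBinder-Subf (φ ∨ ψ) (nbφ , nbψ) = NoBinder-Subf φ nbφ , NoBinder-Subf ψ nbψ
  NoBinder-Subf (φ · ψ) (nbφ , nbψ) = NoBinder-Subf φ nbφ , NoBinder-Subf ψ nbψ
  NoBinder-Subf {y = y} (∀p w φ) (x≢w , nb) with y ≟ w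
  ... | yes _ = x≢w , nb
  ... | no _ = x≢w , NoBinder-Subf φ nb
  NoBinder-Subf {y = y} (∃p w φ) (x≢w , nb) with y ≟ w
  ... | yes _ = x≢w , nb
  ... | no _ = x≢w , NoBinder-Subf φ nb

  NoBinder∧¬FreeIn⇒¬Occurs : ∀ φ → NoBinder x φ → ¬ FreeIn x φ → ¬ Occurs x φ
  NoBinder∧¬FreeIn⇒¬Occurs (var w) _ x∉φ = x∉φ
  NoBinder∧¬FreeIn⇒¬Occurs (sym s) _ _ ()
  NoBinder∧¬FreeIn⇒¬Occurs ⊥p _ _ ()
  NoBinder∧¬FreeIn⇒¬Occurs (¬p φ) nb x∉φ = NoBinder∧¬FreeIn⇒¬Occurs φ nb x∉φ
  NoBinder∧¬FreeIn⇒¬Occurs (φ ⇒ ψ) (nbφ , nbψ) x∉φ =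
    [ NoBinder∧¬FreeIn⇒¬Occurs φ nbφ (x∉φ ∘ inj₁) , NoBinder∧¬FreeIn⇒¬Occurs ψ nbψ (x∉φ ∘ inj₂) ]
  NoBinder∧¬FreeIn⇒¬Occurs (φ ∧ ψ) (nbφ , nbψ) x∉φ =
    [ NoBinder∧¬FreeIn⇒¬Occurs φ nbφ (x∉φ ∘ inj₁) , NoBinder∧¬FreeIn⇒¬Occurs ψ nbψ (x∉φ ∘ inj₂) ]
  NoBinder∧¬FreeIn⇒¬Occurs (φ ∨ ψ) (nbφ , nbψ) x∉φ =
    [ NoBinder∧¬FreeIn⇒¬Occurs φ nbφ (x∉φ ∘ inj₁) , NoBinder∧¬FreeIn⇒¬Occurs ψ nbψ (x∉φ ∘ inj₂) ]
  NoBinder∧¬FreeIn⇒¬Occurs (φ · ψ) (nbφ , nbψ) x∉φ =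
    [ NoBinder∧¬FreeIn⇒¬Occurs φ nbφ (x∉φ ∘ inj₁) , NoBinder∧¬FreeIn⇒¬Occurs ψ nbψ (x∉φ ∘ inj₂) ]
  NoBinder∧¬FreeIn⇒¬Occurs (∀p w φ) (x≢w , nb) x∉φ =
    [ x≢w , NoBinder∧¬FreeIn⇒¬Occurs φ nb (x∉φ ∘ (x≢w ,_)) ]
  NoBinder∧¬FreeIn⇒¬Occurs (∃p w φ) (x≢w , nb) x∉φ =
    [ x≢w , NoBinder∧¬FreeIn⇒¬Occurs φ nb (x∉φ ∘ (x≢w ,_)) ]

  maxVar : Pattern → ℕ
  maxVar (var w) = w
  maxVar (sym _) = 0
  maxVar ⊥p = 0
  maxVar (¬p φ) = maxVar φ
  maxVar (φ ⇒ ψ) = maxVar φ ⊔ maxVar ψ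
  maxVar (φ ∧ ψ) = maxVar φ ⊔ maxVar ψ
  maxVar (φ ∨ ψ) = maxVar φ ⊔ maxVar ψ
  maxVar (φ · ψ) = maxVar φ ⊔ maxVar ψ
  maxVar (∀p w φ) = w ⊔ maxVar φ
  maxVar (∃p w φ) = w ⊔ maxVar φ

  maxVar<⇒¬Occurs : ∀ φ {n} → maxVar φ < n → ¬ Occurs n φ
  maxVar<⇒¬Occurs (var w) w<n n≡w = (>⇒≢ w<n) n≡w
  maxVar<⇒¬Occurs (sym _) _ ()
  maxVar<⇒¬Occurs ⊥p _ ()
  maxVar<⇒¬Occurs (¬p φ) φ<n = maxVar<⇒¬Occurs φ φ<n
  maxVar<⇒¬Occurs (φ ⇒ ψ) φψ<n =
    [ maxVar<⇒¬Occurs φ (m⊔n<o⇒m<o _ _ φψ<n) , maxVar<⇒¬Occurs ψ (m⊔n<o⇒n<o _ _ φψ<n) ]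
  maxVar<⇒¬Occurs (φ ∧ ψ) φψ<n =
    [ maxVar<⇒¬Occurs φ (m⊔n<o⇒m<o _ _ φψ<n) , maxVar<⇒¬Occurs ψ (m⊔n<o⇒n<o _ _ φψ<n) ]
  maxVar<⇒¬Occurs (φ ∨ ψ) φψ<n =
    [ maxVar<⇒¬Occurs φ (m⊔n<o⇒m<o _ _ φψ<n) , maxVar<⇒¬Occurs ψ (m⊔n<o⇒n<o _ _ φψ<n) ]
  maxVar<⇒¬Occurs (φ · ψ) φψ<n =
    [ maxVar<⇒¬Occurs φ (m⊔n<o⇒m<o _ _ φψ<n) , maxVar<⇒¬Occurs ψ (m⊔n<o⇒n<o _ _ φψ<n) ]
  maxVar<⇒¬Occurs (∀p w φ) wφ<n =
    [ >⇒≢ (m⊔n<o⇒m<o _ _ wφ<n) , maxVar<⇒¬Occurs φ (m⊔n<o⇒n<o _ _ wφ<n) ]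
  maxVar<⇒¬Occurs (∃p w φ) wφ<n =
    [ >⇒≢ (m⊔n<o⇒m<o _ _ wφ<n) , maxVar<⇒¬Occurs φ (m⊔n<o⇒n<o _ _ wφ<n) ]

  fresh : EVar → Pattern → EVar
  fresh x φ = suc (maxVar φ ⊔ x)

  fresh-¬Occurs : ∀ x φ → ¬ Occurs (fresh x φ) φ
  fresh-¬Occurs x φ = maxVar<⇒¬Occurs φ (s≤s (m≤m⊔n (maxVar φ) x))

  fresh-≢ : ∀ x φ → fresh x φ ≢ x
  fresh-≢ x φ = >⇒≢ (s≤s (m≤n⊔m (maxVar φ) x))

  infixr 5 _⨾_
  _⨾_ : ⊢ a ⇒ b → ⊢ b ⇒ c → ⊢ a ⇒ c
  _⨾_ = r-syll

  ⇒-refl : ⊢ a ⇒ a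
  ⇒-refl {a} = ax-∧-dup a ⨾ ax-∧-elim a a

  weaken : ⊢ b → ⊢ a ⇒ b
  weaken {b} {a} ⊢b = r-mp ⊢b (r-exp (ax-∧-elim b a))

  ∧-proj₁ : ⊢ a ∧ b ⇒ a
  ∧-proj₁ {a} {b} = ax-∧-elim a b

  ∧-swap : ⊢ a ∧ b ⇒ b ∧ a
  ∧-swap {a} {b} = ax-∧-comm a b

  ∧-proj₂ : ⊢ a ∧ b ⇒ b
  ∧-proj₂ = ∧-swap ⨾ ∧-proj₁

  ∧-mapˡ : ⊢ a ⇒ b → ⊢ a ∧ c ⇒ b ∧ c
  ∧-mapˡ a⇒b = r-imp (a⇒b ⨾ r-exp ⇒-refl)

  ∧-mapʳ : ⊢ a ⇒ b → ⊢ c ∧ a ⇒ c ∧ b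
  ∧-mapʳ a⇒b = ∧-swap ⨾ ∧-mapˡ a⇒b ⨾ ∧-swap

  <_,_> : ⊢ c ⇒ a → ⊢ c ⇒ b → ⊢ c ⇒ a ∧ b
  <_,_> {c} c⇒a c⇒b = ax-∧-dup c ⨾ ∧-mapˡ c⇒a ⨾ ∧-mapʳ c⇒b

  ⇒-mp : ⊢ c ⇒ (a ⇒ b) → ⊢ c ⇒ a → ⊢ c ⇒ b
  ⇒-mp c⇒a⇒b c⇒a = < c⇒a⇒b , c⇒a > ⨾ r-imp ⇒-refl

  ∨-inj₁ : ⊢ a ⇒ a ∨ b
  ∨-inj₁ {a} {b} = ax-∨-intro a b

  ∨-inj₂ : ⊢ b ⇒ a ∨ b
  ∨-inj₂ {b} {a} = ax-∨-intro b a ⨾ ax-∨-comm b a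

  ∨-elim : ⊢ a ⇒ c → ⊢ b ⇒ c → ⊢ a ∨ b ⇒ c
  ∨-elim {a} {c} a⇒c b⇒c = r-∨ a b⇒c ⨾ ax-∨-comm a c ⨾ r-∨ c a⇒c ⨾ ax-∨-idem c

  ∧-∨-elim : ⊢ c ∧ a ⇒ d → ⊢ c ∧ b ⇒ d → ⊢ c ∧ (a ∨ b) ⇒ d
  ∧-∨-elim ca⇒d cb⇒d = ∧-swap ⨾ r-imp (∨-elim (r-exp (∧-swap ⨾ ca⇒d)) (r-exp (∧-swap ⨾ cb⇒d)))

  exfalso : ⊢ c ⇒ ⊥p → ⊢ c ⇒ d
  exfalso {d = d} c⇒⊥ = c⇒⊥ ⨾ ax-⊥ d

  ¬-elim : ⊢ ¬p a ∧ a ⇒ ⊥p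
  ¬-elim {a} = r-imp (ax-¬⇒ a)

  ¬-intro : ⊢ c ∧ a ⇒ ⊥p → ⊢ c ⇒ ¬p a
  ¬-intro {a = a} ca⇒⊥ = r-exp ca⇒⊥ ⨾ ax-⇒¬ a

  lem-cases : ⊢ c ∧ a ⇒ d → ⊢ c ∧ ¬p a ⇒ d → ⊢ c ⇒ d
  lem-cases {a = a} ca⇒d c¬a⇒d = ⇒-mp (r-exp (∧-∨-elim ca⇒d c¬a⇒d)) (weaken (ax-lem a))

  ¬¬-elim : ⊢ ¬p (¬p a) ⇒ a
  ¬¬-elim = lem-cases ∧-proj₂ (exfalso ¬-elim)

  ¬¬-intro : ⊢ a ⇒ ¬p (¬p a)
  ¬¬-intro = ¬-intro (∧-swap ⨾ ¬-elim)

  contraposition : ⊢ a ⇒ b → ⊢ ¬p b ⇒ ¬p a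
  contraposition a⇒b = ¬-intro (∧-mapʳ a⇒b ⨾ ¬-elim)

  ⇒-contraposition : ⊢ (a ⇒ b) ⇒ (¬p b ⇒ ¬p a)
  ⇒-contraposition =
    r-exp (¬-intro (< ∧-proj₁ ⨾ ∧-proj₂ , ⇒-mp (∧-proj₁ ⨾ ∧-proj₁) ∧-proj₂ > ⨾ ¬-elim))

  ∀-mono : ∀ x → ⊢ a ⇒ b → ⊢ ∀p x a ⇒ ∀p x b
  ∀-mono {a} {b} x a⇒b = r-mp (r-gen x a⇒b) (ax-∀-dist x a b)

  ∃-mono : ∀ x → ⊢ a ⇒ b → ⊢ ∃p x a ⇒ ∃p x b
  ∃-mono {a} {b} x a⇒b =
    ax-∃⇒¬∀¬ x a ⨾ contraposition (∀-mono x (contraposition a⇒b)) ⨾ ax-¬∀¬⇒∃ x b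

  ∃-elim : ¬ Occurs x a → ⊢ ∃p x a ⇒ a
  ∃-elim {x} {a} x∉a = ax-∃⇒¬∀¬ x a ⨾ contraposition (ax-∀-vac x (¬p a) x∉a) ⨾ ¬¬-elim

  ∀∃-mp : ⊢ ∀p x (a ⇒ b) ∧ ∃p x a ⇒ ∃p x b
  ∀∃-mp {x} {a} {b} =
    ⇒-mp (∧-proj₁ ⨾ ∀-mono x ⇒-contraposition ⨾ ax-∀-dist x (¬p b) (¬p a) ⨾ ⇒-contraposition)
         (∧-proj₂ ⨾ ax-∃⇒¬∀¬ x a)
    ⨾ ax-¬∀¬⇒∃ x b

  ∃∀-∧ : ⊢ ∃p x a ∧ ∀p x b ⇒ ∃p x (a ∧ b)
  ∃∀-∧ {x} = ∧-swap ⨾ ∧-mapˡ (∀-mono x (r-exp ∧-swap)) ⨾ ∀∃-mp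

  ⌊⌋-elim : ⊢ ⌊ a ⌋ ⇒ a
  ⌊⌋-elim {a} = contraposition (ax-dfd-in (¬p a)) ⨾ ¬¬-elim

  ⌊⌋-intro : ⊢ a → ⊢ ⌊ a ⌋
  ⌊⌋-intro {a} ⊢a =
    r-mp (r-frameʳ (sym dfd) (⇒-mp (ax-¬⇒ a) (weaken ⊢a)) ⨾ ax-dfd-⊥) (ax-⇒¬ ⌈ ¬p a ⌉)

  ⌊⌋-mono : ⊢ a ⇒ b → ⊢ ⌊ a ⌋ ⇒ ⌊ b ⌋
  ⌊⌋-mono a⇒b = contraposition (r-frameʳ (sym dfd) (contraposition a⇒b))

  ⌊⌋-split : ⊢ b ⇒ (⌊ a ⌋ ∧ b) ∨ ¬p ⌊ a ⌋
  ⌊⌋-split = lem-cases (∧-swap ⨾ ∨-inj₁) (∧-proj₂ ⨾ ∨-inj₂)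

  ⌊⌋-resolve : ⊢ ⌊ a ⌋ ∧ (b ∨ ¬p ⌊ a ⌋) ⇒ b
  ⌊⌋-resolve = ∧-∨-elim ∧-proj₂ (exfalso (∧-swap ⨾ ¬-elim))

  -- ¬ ⌊ a ⌋ is, up to double negation, the definedness pattern ⌈ ¬p a ⌉,
  -- so it absorbs application.
  ¬⌊⌋-absorbˡ : ⊢ ¬p ⌊ a ⌋ · c ⇒ ¬p ⌊ a ⌋
  ¬⌊⌋-absorbˡ {a} {c} = r-frameˡ c ¬¬-elim ⨾ ax-dfdˡ (¬p a) c ⨾ ¬¬-intro

  ¬⌊⌋-absorbʳ : ⊢ c · ¬p ⌊ a ⌋ ⇒ ¬p ⌊ a ⌋
  ¬⌊⌋-absorbʳ {c} {a} = r-frameʳ c ¬¬-elim ⨾ ax-dfdʳ (¬p a) c ⨾ ¬¬-intro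

  ⌊⌋-frameˡ : ⊢ ⌊ Q ⌋ ∧ (a · c) ⇒ (⌊ Q ⌋ ∧ a) · c
  ⌊⌋-frameˡ {Q} {a} {c} =
    ∧-mapʳ (r-frameˡ c ⌊⌋-split ⨾ ax-prop-∨ˡ (⌊ Q ⌋ ∧ a) (¬p ⌊ Q ⌋) c ⨾ r-∨ _ ¬⌊⌋-absorbˡ)
    ⨾ ⌊⌋-resolve

  ⌊⌋-frameʳ : ⊢ ⌊ Q ⌋ ∧ (c · a) ⇒ c · (⌊ Q ⌋ ∧ a)
  ⌊⌋-frameʳ {Q} {c} {a} =
    ∧-mapʳ (r-frameʳ c ⌊⌋-split ⨾ ax-prop-∨ʳ (⌊ Q ⌋ ∧ a) (¬p ⌊ Q ⌋) c ⨾ r-∨ _ ¬⌊⌋-absorbʳ)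
    ⨾ ⌊⌋-resolve

  infix 2 _⊢_⟶_ _⊢_⟷_ _⊣⊢_

  _⊢_⟶_ : Pattern → Pattern → Pattern → Set
  Γ ⊢ a ⟶ b = ⊢ Γ ∧ a ⇒ b

  _⊢_⟷_ : Pattern → Pattern → Pattern → Set
  Γ ⊢ a ⟷ b = (Γ ⊢ a ⟶ b) × (Γ ⊢ b ⟶ a)

  _⊣⊢_ : Pattern → Pattern → Set
  a ⊣⊢ b = (⊢ a ⇒ b) × (⊢ b ⇒ a)

  under : a ⊣⊢ b → Γ ⊢ a ⟷ b
  under (a⇒b , b⇒a) = ∧-proj₂ ⨾ a⇒b , ∧-proj₂ ⨾ b⇒a

  discharge : ⊢ Γ → Γ ⊢ a ⟷ b → a ⊣⊢ b
  discharge ⊢Γ (a⟶b , b⟶a) = r-mp ⊢Γ (r-exp a⟶b) , r-mp ⊢Γ (r-exp b⟶a)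

  ⟶-trans : Γ ⊢ a ⟶ b → Γ ⊢ b ⟶ c → Γ ⊢ a ⟶ c
  ⟶-trans a⟶b b⟶c = < ∧-proj₁ , a⟶b > ⨾ b⟶c

  ¬-⟶ : Γ ⊢ a ⟶ b → Γ ⊢ ¬p b ⟶ ¬p a
  ¬-⟶ a⟶b = ¬-intro (< ∧-proj₁ ⨾ ∧-proj₂ , < ∧-proj₁ ⨾ ∧-proj₁ , ∧-proj₂ > ⨾ a⟶b > ⨾ ¬-elim)

  ⇒-⟶ : Γ ⊢ a′ ⟶ a → Γ ⊢ b ⟶ b′ → Γ ⊢ (a ⇒ b) ⟶ (a′ ⇒ b′)
  ⇒-⟶ a′⟶a b⟶b′ =
    r-exp (< ∧-proj₁ ⨾ ∧-proj₁ , ⇒-mp (∧-proj₁ ⨾ ∧-proj₂) (< ∧-proj₁ ⨾ ∧-proj₁ , ∧-proj₂ > ⨾ a′⟶a) >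
           ⨾ b⟶b′)

  ∧-⟶ : Γ ⊢ a ⟶ a′ → Γ ⊢ b ⟶ b′ → Γ ⊢ a ∧ b ⟶ a′ ∧ b′
  ∧-⟶ a⟶a′ b⟶b′ =
    < < ∧-proj₁ , ∧-proj₂ ⨾ ∧-proj₁ > ⨾ a⟶a′ , < ∧-proj₁ , ∧-proj₂ ⨾ ∧-proj₂ > ⨾ b⟶b′ >

  ∨-⟶ : Γ ⊢ a ⟶ a′ → Γ ⊢ b ⟶ b′ → Γ ⊢ a ∨ b ⟶ a′ ∨ b′
  ∨-⟶ a⟶a′ b⟶b′ = ∧-∨-elim (a⟶a′ ⨾ ∨-inj₁) (b⟶b′ ⨾ ∨-inj₂)

  ·-⟶ : ⌊ Q ⌋ ⊢ a ⟶ a′ → ⌊ Q ⌋ ⊢ b ⟶ b′ → ⌊ Q ⌋ ⊢ a · b ⟶ a′ · b′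
  ·-⟶ a⟶a′ b⟶b′ = < ∧-proj₁ , ⌊⌋-frameˡ ⨾ r-frameˡ _ a⟶a′ > ⨾ ⌊⌋-frameʳ ⨾ r-frameʳ _ b⟶b′

  ∀-⟶ : ∀ z → ¬ Occurs z Γ → Γ ⊢ a ⟶ b → Γ ⊢ ∀p z a ⟶ ∀p z b
  ∀-⟶ {Γ} {a} {b} z z∉Γ a⟶b = r-imp (ax-∀-vac z Γ z∉Γ ⨾ ∀-mono z (r-exp a⟶b) ⨾ ax-∀-dist z a b)

  ∃-⟶ : ∀ z → ¬ Occurs z Γ → Γ ⊢ a ⟶ b → Γ ⊢ ∃p z a ⟶ ∃p z b
  ∃-⟶ {Γ} z z∉Γ a⟶b = r-imp (ax-∀-vac z Γ z∉Γ ⨾ ∀-mono z (r-exp a⟶b) ⨾ r-exp ∀∃-mp)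

  ⟷-refl : Γ ⊢ a ⟷ a
  ⟷-refl = ∧-proj₂ , ∧-proj₂

  ⟷-trans : Γ ⊢ a ⟷ b → Γ ⊢ b ⟷ c → Γ ⊢ a ⟷ c
  ⟷-trans (a⟶b , b⟶a) (b⟶c , c⟶b) = ⟶-trans a⟶b b⟶c , ⟶-trans c⟶b b⟶a

  ¬-⟷ : Γ ⊢ a ⟷ b → Γ ⊢ ¬p a ⟷ ¬p b
  ¬-⟷ (a⟶b , b⟶a) = ¬-⟶ b⟶a , ¬-⟶ a⟶b

  ⇒-⟷ : Γ ⊢ a ⟷ a′ → Γ ⊢ b ⟷ b′ → Γ ⊢ (a ⇒ b) ⟷ (a′ ⇒ b′)
  ⇒-⟷ (a⟶a′ , a′⟶a) (b⟶b′ , b′⟶b) = ⇒-⟶ a′⟶a b⟶b′ , ⇒-⟶ a⟶a′ b′⟶b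

  ∧-⟷ : Γ ⊢ a ⟷ a′ → Γ ⊢ b ⟷ b′ → Γ ⊢ a ∧ b ⟷ a′ ∧ b′
  ∧-⟷ (a⟶a′ , a′⟶a) (b⟶b′ , b′⟶b) = ∧-⟶ a⟶a′ b⟶b′ , ∧-⟶ a′⟶a b′⟶b

  ∨-⟷ : Γ ⊢ a ⟷ a′ → Γ ⊢ b ⟷ b′ → Γ ⊢ a ∨ b ⟷ a′ ∨ b′
  ∨-⟷ (a⟶a′ , a′⟶a) (b⟶b′ , b′⟶b) = ∨-⟶ a⟶a′ b⟶b′ , ∨-⟶ a′⟶a b′⟶b

  ·-⟷ : ⌊ Q ⌋ ⊢ a ⟷ a′ → ⌊ Q ⌋ ⊢ b ⟷ b′ → ⌊ Q ⌋ ⊢ a · b ⟷ a′ · b′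
  ·-⟷ (a⟶a′ , a′⟶a) (b⟶b′ , b′⟶b) = ·-⟶ a⟶a′ b⟶b′ , ·-⟶ a′⟶a b′⟶b

  ∀-⟷ : ∀ z → ¬ Occurs z Γ → Γ ⊢ a ⟷ b → Γ ⊢ ∀p z a ⟷ ∀p z b
  ∀-⟷ z z∉Γ (a⟶b , b⟶a) = ∀-⟶ z z∉Γ a⟶b , ∀-⟶ z z∉Γ b⟶a

  ∃-⟷ : ∀ z → ¬ Occurs z Γ → Γ ⊢ a ⟷ b → Γ ⊢ ∃p z a ⟷ ∃p z b
  ∃-⟷ z z∉Γ (a⟶b , b⟶a) = ∃-⟶ z z∉Γ a⟶b , ∃-⟶ z z∉Γ b⟶a

  ≐-sym : ⊢ a ≐ b ⇒ b ≐ a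
  ≐-sym = ⌊⌋-mono ∧-swap

  ≐⇒⟷ : (a ≐ b) ⊢ a ⟷ b
  ≐⇒⟷ = ⇒-mp (∧-proj₁ ⨾ ⌊⌋-elim ⨾ ∧-proj₁) ∧-proj₂ , ⇒-mp (∧-proj₁ ⨾ ⌊⌋-elim ⨾ ∧-proj₂) ∧-proj₂

  ≐-¬Occurs : z ≢ x → z ≢ y → ¬ Occurs z (var x ≐ var y)
  ≐-¬Occurs z≢x z≢y = [ (λ ()) , [ [ z≢x , z≢y ] , [ z≢y , z≢x ] ] ]

  ≐-subst : ∀ φ → FreeFor x y φ → (var x ≐ var y) ⊢ Subf x y φ ⟷ φ
  ≐-subst {x} (var w) _ with x ≟ w
  ... | yes refl = swap ≐⇒⟷
  ... | no _ = ⟷-refl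
  ≐-subst (sym s) _ = ⟷-refl
  ≐-subst ⊥p _ = ⟷-refl
  ≐-subst (¬p φ) ff = ¬-⟷ (≐-subst φ ff)
  ≐-subst (φ ⇒ ψ) (ffφ , ffψ) = ⇒-⟷ (≐-subst φ ffφ) (≐-subst ψ ffψ)
  ≐-subst (φ ∧ ψ) (ffφ , ffψ) = ∧-⟷ (≐-subst φ ffφ) (≐-subst ψ ffψ)
  ≐-subst (φ ∨ ψ) (ffφ , ffψ) = ∨-⟷ (≐-subst φ ffφ) (≐-subst ψ ffψ)
  ≐-subst (φ · ψ) (ffφ , ffψ) = ·-⟷ (≐-subst φ ffφ) (≐-subst ψ ffψ)
  ≐-subst {x} {y} (∀p w φ) ff with x ≟ w | ff
  ... | yes _ | _ = ⟷-refl
  ... | no x≢w | inj₁ x∉φ rewrite Subf-¬FreeIn {y = y} φ (x∉φ ∘ (x≢w ,_)) = ⟷-refl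
  ... | no x≢w | inj₂ (y≢w , ffφ) = ∀-⟷ w (≐-¬Occurs (≢-sym x≢w) (≢-sym y≢w)) (≐-subst φ ffφ)
  ≐-subst {x} {y} (∃p w φ) ff with x ≟ w | ff
  ... | yes _ | _ = ⟷-refl
  ... | no x≢w | inj₁ x∉φ rewrite Subf-¬FreeIn {y = y} φ (x∉φ ∘ (x≢w ,_)) = ⟷-refl
  ... | no x≢w | inj₂ (y≢w , ffφ) = ∃-⟷ w (≐-¬Occurs (≢-sym x≢w) (≢-sym y≢w)) (≐-subst φ ffφ)

  ∀⇒∃≐ : y ≢ x → ⊢ ∀p x a ⇒ ∃p x (var x ≐ var y ∧ a)
  ∀⇒∃≐ {y} {x} y≢x = < weaken (ax-exists x y y≢x) , ⇒-refl > ⨾ ∃∀-∧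

  ∀-elim : ∀ φ → y ≢ x → FreeFor x y φ → ¬ Occurs x (Subf x y φ) → ⊢ ∀p x φ ⇒ Subf x y φ
  ∀-elim φ y≢x ff x∉φ[y/x] = ∀⇒∃≐ y≢x ⨾ ∃-mono _ (proj₂ (≐-subst φ ff)) ⨾ ∃-elim x∉φ[y/x]

  ∀-α : ∀ x φ → NoBinder x φ → z ≢ x → ¬ Occurs z φ → ∀p x φ ⊣⊢ ∀p z (Subf x z φ)
  ∀-α {z} x φ nb z≢x z∉φ =
      ax-∀-vac z (∀p x φ) [ z≢x , z∉φ ] ⨾ ∀-mono z (∀-elim φ z≢x (¬Occurs⇒FreeFor φ z∉φ) x∉φ′)
    , ax-∀-vac x (∀p z φ′) [ ≢-sym z≢x , x∉φ′ ] ⨾ ∀-mono x back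
    where
    φ′ : Pattern
    φ′ = Subf x z φ
    x∉φ′ : ¬ Occurs x φ′
    x∉φ′ = NoBinder∧¬FreeIn⇒¬Occurs φ′ (NoBinder-Subf φ nb) (¬FreeIn-Subf φ (≢-sym z≢x))
    back : ⊢ ∀p z φ′ ⇒ φ
    back = subst (λ χ → ¬ Occurs z χ → ⊢ ∀p z φ′ ⇒ χ) (Subf-inverse x φ z∉φ)
                 (∀-elim φ′ (≢-sym z≢x) (NoBinder⇒FreeFor φ′ (NoBinder-Subf φ nb))) z∉φ

  ∃-α : ∀ x φ → NoBinder x φ → z ≢ x → ¬ Occurs z φ → ∃p x φ ⊣⊢ ∃p z (Subf x z φ)
  ∃-α {z} x φ nb z≢x z∉φ =
      ax-∃⇒¬∀¬ x φ ⨾ contraposition (proj₂ ¬φ-α) ⨾ ax-¬∀¬⇒∃ z _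
    , ax-∃⇒¬∀¬ z _ ⨾ contraposition (proj₁ ¬φ-α) ⨾ ax-¬∀¬⇒∃ x φ
    where
    ¬φ-α : ∀p x (¬p φ) ⊣⊢ ∀p z (¬p (Subf x z φ))
    ¬φ-α = ∀-α x (¬p φ) nb z≢x z∉φ

  -- A provable context without variables: under it, ⟷ is plain provable equivalence.
  ⌊⊤⌋ : Pattern
  ⌊⊤⌋ = ⌊ ¬p ⊥p ⌋

  ⊢⌊⊤⌋ : ⊢ ⌊⊤⌋
  ⊢⌊⊤⌋ = ⌊⌋-intro (r-mp ⇒-refl (ax-⇒¬ ⊥p))

  ¬Occurs-⌊⊤⌋ : ∀ z → ¬ Occurs z ⌊⊤⌋
  ¬Occurs-⌊⊤⌋ _ = [ (λ ()) , (λ ()) ]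

  renameBinders : EVar → Pattern → Pattern
  renameBinders x (var w) = var w
  renameBinders x (sym s) = sym s
  renameBinders x ⊥p = ⊥p
  renameBinders x (¬p φ) = ¬p (renameBinders x φ)
  renameBinders x (φ ⇒ ψ) = renameBinders x φ ⇒ renameBinders x ψ
  renameBinders x (φ ∧ ψ) = renameBinders x φ ∧ renameBinders x ψ
  renameBinders x (φ ∨ ψ) = renameBinders x φ ∨ renameBinders x ψ
  renameBinders x (φ · ψ) = renameBinders x φ · renameBinders x ψ
  renameBinders x (∀p w φ) with x ≟ w
  ... | yes _ = let φ′ = renameBinders x φ in ∀p (fresh x φ′) (Subf x (fresh x φ′) φ′)
  ... | no _ = ∀p w (renameBinders x φ)
  renameBinders x (∃p w φ) with x ≟ w
  ... | yes _ = let φ′ = renameBinders x φ in ∃p (fresh x φ′) (Subf x (fresh x φ′) φ′)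
  ... | no _ = ∃p w (renameBinders x φ)

  renameBinders-NoBinder : ∀ x φ → NoBinder x (renameBinders x φ)
  renameBinders-NoBinder x (var w) = tt
  renameBinders-NoBinder x (sym s) = tt
  renameBinders-NoBinder x ⊥p = tt
  renameBinders-NoBinder x (¬p φ) = renameBinders-NoBinder x φ
  renameBinders-NoBinder x (φ ⇒ ψ) = renameBinders-NoBinder x φ , renameBinders-NoBinder x ψ
  renameBinders-NoBinder x (φ ∧ ψ) = renameBinders-NoBinder x φ , renameBinders-NoBinder x ψ
  renameBinders-NoBinder x (φ ∨ ψ) = renameBinders-NoBinder x φ , renameBinders-NoBinder x ψ
  renameBinders-NoBinder x (φ · ψ) = renameBinders-NoBinder x φ , renameBinders-NoBinder x ψ
  renameBinders-NoBinder x (∀p w φ) with x ≟ w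
  ... | yes _ =
    ≢-sym (fresh-≢ x (renameBinders x φ)) , NoBinder-Subf (renameBinders x φ) (renameBinders-NoBinder x φ)
  ... | no x≢w = x≢w , renameBinders-NoBinder x φ
  renameBinders-NoBinder x (∃p w φ) with x ≟ w
  ... | yes _ =
    ≢-sym (fresh-≢ x (renameBinders x φ)) , NoBinder-Subf (renameBinders x φ) (renameBinders-NoBinder x φ)
  ... | no x≢w = x≢w , renameBinders-NoBinder x φ

  renameBinders-¬FreeIn : ∀ φ → ¬ FreeIn x φ → ¬ FreeIn x (renameBinders x φ)
  renameBinders-¬FreeIn (var w) x∉φ = x∉φ
  renameBinders-¬FreeIn (sym s) x∉φ = x∉φ
  renameBinders-¬FreeIn ⊥p x∉φ = x∉φ
  renameBinders-¬FreeIn (¬p φ) x∉φ = renameBinders-¬FreeIn φ x∉φ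
  renameBinders-¬FreeIn (φ ⇒ ψ) x∉φ =
    [ renameBinders-¬FreeIn φ (x∉φ ∘ inj₁) , renameBinders-¬FreeIn ψ (x∉φ ∘ inj₂) ]
  renameBinders-¬FreeIn (φ ∧ ψ) x∉φ =
    [ renameBinders-¬FreeIn φ (x∉φ ∘ inj₁) , renameBinders-¬FreeIn ψ (x∉φ ∘ inj₂) ]
  renameBinders-¬FreeIn (φ ∨ ψ) x∉φ =
    [ renameBinders-¬FreeIn φ (x∉φ ∘ inj₁) , renameBinders-¬FreeIn ψ (x∉φ ∘ inj₂) ]
  renameBinders-¬FreeIn (φ · ψ) x∉φ =
    [ renameBinders-¬FreeIn φ (x∉φ ∘ inj₁) , renameBinders-¬FreeIn ψ (x∉φ ∘ inj₂) ]
  renameBinders-¬FreeIn {x} (∀p w φ) x∉φ with x ≟ w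
  ... | yes _ = ¬FreeIn-Subf (renameBinders x φ) (≢-sym (fresh-≢ x (renameBinders x φ))) ∘ proj₂
  ... | no x≢w = renameBinders-¬FreeIn φ (x∉φ ∘ (x≢w ,_)) ∘ proj₂
  renameBinders-¬FreeIn {x} (∃p w φ) x∉φ with x ≟ w
  ... | yes _ = ¬FreeIn-Subf (renameBinders x φ) (≢-sym (fresh-≢ x (renameBinders x φ))) ∘ proj₂
  ... | no x≢w = renameBinders-¬FreeIn φ (x∉φ ∘ (x≢w ,_)) ∘ proj₂

  renameBinders-⟷ : ∀ x φ → ⌊⊤⌋ ⊢ φ ⟷ renameBinders x φ
  renameBinders-⟷ x (var w) = ⟷-refl
  renameBinders-⟷ x (sym s) = ⟷-refl
  renameBinders-⟷ x ⊥p = ⟷-refl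
  renameBinders-⟷ x (¬p φ) = ¬-⟷ (renameBinders-⟷ x φ)
  renameBinders-⟷ x (φ ⇒ ψ) = ⇒-⟷ (renameBinders-⟷ x φ) (renameBinders-⟷ x ψ)
  renameBinders-⟷ x (φ ∧ ψ) = ∧-⟷ (renameBinders-⟷ x φ) (renameBinders-⟷ x ψ)
  renameBinders-⟷ x (φ ∨ ψ) = ∨-⟷ (renameBinders-⟷ x φ) (renameBinders-⟷ x ψ)
  renameBinders-⟷ x (φ · ψ) = ·-⟷ (renameBinders-⟷ x φ) (renameBinders-⟷ x ψ)
  renameBinders-⟷ x (∀p w φ) with x ≟ w
  ... | yes refl =
    ⟷-trans (∀-⟷ x (¬Occurs-⌊⊤⌋ x) (renameBinders-⟷ x φ))
            (under (∀-α x φ′ (renameBinders-NoBinder x φ) (fresh-≢ x φ′) (fresh-¬Occurs x φ′)))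
    where
    φ′ : Pattern
    φ′ = renameBinders x φ
  ... | no _ = ∀-⟷ w (¬Occurs-⌊⊤⌋ w) (renameBinders-⟷ x φ)
  renameBinders-⟷ x (∃p w φ) with x ≟ w
  ... | yes refl =
    ⟷-trans (∃-⟷ x (¬Occurs-⌊⊤⌋ x) (renameBinders-⟷ x φ))
            (under (∃-α x φ′ (renameBinders-NoBinder x φ) (fresh-≢ x φ′) (fresh-¬Occurs x φ′)))
    where
    φ′ : Pattern
    φ′ = renameBinders x φ
  ... | no _ = ∃-⟷ w (¬Occurs-⌊⊤⌋ w) (renameBinders-⟷ x φ)

  ∀-intro : ∀ φ → ¬ FreeIn x φ → ⊢ φ ⇒ ∀p x φ
  ∀-intro {x} φ x∉φ = proj₁ φ⊣⊢φ′ ⨾ ax-∀-vac x φ′ x∉φ′ ⨾ ∀-mono x (proj₂ φ⊣⊢φ′)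
    where
    φ′ : Pattern
    φ′ = renameBinders x φ
    φ⊣⊢φ′ : φ ⊣⊢ φ′
    φ⊣⊢φ′ = discharge ⊢⌊⊤⌋ (renameBinders-⟷ x φ)
    x∉φ′ : ¬ Occurs x φ′
    x∉φ′ = NoBinder∧¬FreeIn⇒¬Occurs φ′ (renameBinders-NoBinder x φ) (renameBinders-¬FreeIn φ x∉φ)

  Subf⇒∃ : ∀ φ → x ≢ y → FreeFor x y φ → ⊢ Subf x y φ ⇒ ∃p x φ
  Subf⇒∃ {x} φ x≢y ff =
    ∀-intro _ (¬FreeIn-Subf φ x≢y) ⨾ ∀⇒∃≐ (≢-sym x≢y) ⨾ ∃-mono x (proj₁ (≐-subst φ ff))

  -- The axiom ∃x (x = y) requires y ≢ x, so route through a fresh w: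
  -- φ ⇒ ∃w (x = w ∧ φ) ⇒ ∃w (Subf x w φ) ⇒ ∃w ∃x φ ⇒ ∃x φ.
  ⇒∃ : ∀ x φ → ⊢ φ ⇒ ∃p x φ
  ⇒∃ x φ =
    ax-∀-vac w φ w∉φ ⨾ ∀⇒∃≐ x≢w
    ⨾ ∃-mono w (∧-mapˡ ≐-sym ⨾ proj₂ (≐-subst φ ff) ⨾ Subf⇒∃ φ x≢w ff)
    ⨾ ∃-elim [ fresh-≢ x φ , w∉φ ]
    where
    w : EVar
    w = fresh x φ
    w∉φ : ¬ Occurs w φ
    w∉φ = fresh-¬Occurs x φ
    x≢w : x ≢ w
    x≢w = ≢-sym (fresh-≢ x φ)
    ff : FreeFor x w φ
    ff = ¬Occurs⇒FreeFor φ w∉φ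

mainTheorem7 : (Sym : Set) (dfd : Sym) → let open MG Sym dfd in
               (φ : Pattern) (x y : EVar) → FreeFor x y φ → ⊢ Subf x y φ ⇒ ∃p x φ
mainTheorem7 Sym dfd φ x y x-free-for-y = by-cases (x ≟ y)
  where
  open MG Sym dfd
  open Metatheory Sym dfd
  by-cases : Dec (x ≡ y) → ⊢ Subf x y φ ⇒ ∃p x φ
  by-cases (yes refl) = subst (λ ψ → ⊢ ψ ⇒ ∃p x φ) (≡-sym (Subf-self x φ)) (⇒∃ x φ)
  by-cases (no x≢y) = Subf⇒∃ φ x≢y x-free-for-y
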